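{- Let $\phi=(\phi_1,\phi_2,\dots)$ be any sequence of permutations with $\phi_i\in\mathfrak S_i$. If $\overline D$ is a general Dyck path, then $\mathrm{Osweep}(\overline D)$ is a general Dyck path.
   Context: A sequence $P=(b_1,\dots,b_N)$ of integers is a general Dyck path if $b_1+\cdots+b_N=0$ and $b_1+\cdots+b_{i-1}\ge 0$ for all $i$. The $i$-th arrow of $P$ is the vector $(1,b_i)$ with starting rank $r_i=b_1+\cdots+b_{i-1}$. Order sweep map: let $k$ be the number of indices with $r_i=0$, these being $i_1<\dots<i_k$. $\mathrm{Osweep}(P)$ lists the steps $b_i$ as follows: first the arrows of starting rank $0$, then rank $1$, $2$, etc. (then negative ranks $-\infty,\dots,-2,-1$ if any); arrows of equal starting rank $r\ne0$ are listed from right to left (decreasing $i$); arrows of starting rank $0$ are listed in the order $b_{i_{\phi_k(1)}},\dots,b_{i_{\phi_k(k)}}$. -}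

module Defs where

open import Data.Nat using (ℕ; suc; _<_)
open import Data.Integer using (ℤ; +_; -[1+_]; _+_; _≤_; ∣_∣; 0ℤ)
open import Data.Integer.Properties using (_≟_)
open import Data.List using (List; []; _∷_; map; filter; foldr; take; length; _++_; concatMap; reverse; upTo; allFin)
open import Data.Product using (_×_; _,_; proj₁; proj₂)
open import Data.Fin.Permutation using (Permutation′; _⟨$⟩ʳ_)
import Data.Vec as Vec
open import Relation.Binary.PropositionalEquality using (_≡_)

import Data.Nat.ListAction as ℕL

sumℤ : List ℤ → ℤ
sumℤ = foldr _+_ 0ℤ

IsGeneralDyck : List ℤ → Set
IsGeneralDyck bs = (sumℤ bs ≡ 0ℤ) × (∀ i → i < length bs → 0ℤ ≤ sumℤ (take i bs))

-- arrows (starting rank , step), starting from rank r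
arrowsFrom : ℤ → List ℤ → List (ℤ × ℤ)
arrowsFrom r [] = []
arrowsFrom r (b ∷ bs) = (r , b) ∷ arrowsFrom (r + b) bs

stepsAt : ℤ → List (ℤ × ℤ) → List ℤ
stepsAt r as = map proj₂ (filter (λ p → proj₁ p ≟ r) as)

-- φ k is a permutation of Fin k (0-based version of φ_k ∈ 𝔖_k)
Osweep : ((k : ℕ) → Permutation′ k) → List ℤ → List ℤ
Osweep φ bs =
  map (λ j → Vec.lookup (Vec.fromList z) (φ (length z) ⟨$⟩ʳ j)) (allFin (length z))
  ++ concatMap (λ r → reverse (stepsAt (+ r) as)) (map suc (upTo B))
  ++ concatMap (λ m → reverse (stepsAt -[1+ m ] as)) (reverse (upTo B))
  where
    as = arrowsFrom 0ℤ bs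
    z = stepsAt 0ℤ as
    -- every starting rank has absolute value ≤ B
    B = ℕL.sum (map ∣_∣ bs)

-- Clip a path at height r: the clipped height min(rank, r) only moves on an arrow that starts
-- below r (by its full step) or at r (by the negative part of its step).  Comparing the clipped
-- heights at the two ends of a Dyck path therefore shows that, for every r, the steps of all
-- arrows starting below r plus the negative parts of the steps starting at r sum to at least 0.
-- The order sweep lists the arrows rank by rank; inside the block of rank r its height starts at
-- the sum of the steps below r and never drops by more than the negative parts of that block,
-- however the block is ordered.
module Submission where

open import Defs
open import Data.Nat using (ℕ; zero; suc; s≤s; z≤n) renaming (_<_ to _<ℕ_)
open import Data.Integer using (ℤ; +_; -[1+_]; _+_; -_; _≤_; _<_; _⊓_; ∣_∣; 0ℤ; -≤+; -<+)
  renaming (suc to sucℤ)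
open import Data.Integer.Properties
open import Data.List using (List; []; _∷_; map; filter; take; length; _++_; concatMap; reverse;
  upTo; applyUpTo; allFin; tabulate)
import Data.List.Properties as List
open import Data.List.Relation.Unary.All using (All; []; _∷_)
import Data.List.Relation.Unary.All as All
import Data.Nat.ListAction as ℕL
open import Data.Product using (_×_; _,_; proj₁; proj₂)
open import Data.Fin using (Fin)
import Data.Fin as Fin
open import Data.Fin.Permutation using (Permutation′; _⟨$⟩ʳ_)
import Data.Vec as Vec
open import Function using (_∘_; _$_; id)
open import Relation.Binary.PropositionalEquality
open import Relation.Binary.Definitions using (tri<; tri≈; tri>)
open import Relation.Nullary using (¬_)
import Algebra.Properties.CommutativeMonoid.Sum as MonoidSum
open import Algebra.Properties.CommutativeSemigroup +-commutativeSemigroup using (x∙yz≈y∙xz)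

private
  variable
    r s b : ℤ
    as : List (ℤ × ℤ)

module Σ = MonoidSum +-0-commutativeMonoid

i<suc[i] : ∀ i → i < sucℤ i
i<suc[i] i = suc[i]≤j⇒i<j ≤-refl

i<j⇒i<suc[j] : ∀ {i j} → i < j → i < sucℤ j
i<j⇒i<suc[j] = suc[i]≤j⇒i<j ∘ i≤j⇒i≤1+j ∘ i<j⇒suc[i]≤j

i<j⇒j≮suc[i] : ∀ {i j} → i < j → ¬ j < sucℤ i
i<j⇒j≮suc[i] i<j j<suc[i] = <-irrefl refl (≤-<-trans (i<j⇒suc[i]≤j i<j) j<suc[i])

i≤i+j⇒0≤j : ∀ {i j} → i ≤ i + j → 0ℤ ≤ j
i≤i+j⇒0≤j {i} {j} i≤i+j = begin
  0ℤ            ≡⟨ +-inverseˡ i ⟨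
  - i + i       ≤⟨ +-monoʳ-≤ (- i) i≤i+j ⟩
  - i + (i + j) ≡⟨ +-assoc (- i) i j ⟨
  - i + i + j   ≡⟨ cong (_+ j) (+-inverseˡ i) ⟩
  0ℤ + j        ≡⟨ +-identityˡ j ⟩
  j             ∎
  where open ≤-Reasoning

i≤+∣i∣ : ∀ i → i ≤ + ∣ i ∣
i≤+∣i∣ (+ n) = ≤-refl
i≤+∣i∣ -[1+ n ] = -≤+

sumℤ-++ : ∀ xs ys → sumℤ (xs ++ ys) ≡ sumℤ xs + sumℤ ys
sumℤ-++ [] ys = sym (+-identityˡ _)
sumℤ-++ (x ∷ xs) ys = trans (cong (_+_ x) (sumℤ-++ xs ys)) (sym (+-assoc x _ _))

sumℤ-reverse : ∀ xs → sumℤ (reverse xs) ≡ sumℤ xs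
sumℤ-reverse [] = refl
sumℤ-reverse (x ∷ xs) = begin
  sumℤ (reverse (x ∷ xs))      ≡⟨ cong sumℤ (List.unfold-reverse x xs) ⟩
  sumℤ (reverse xs ++ x ∷ [])  ≡⟨ sumℤ-++ (reverse xs) (x ∷ []) ⟩
  sumℤ (reverse xs) + (x + 0ℤ) ≡⟨ cong₂ _+_ (sumℤ-reverse xs) (+-identityʳ x) ⟩
  sumℤ xs + x                  ≡⟨ +-comm (sumℤ xs) x ⟩
  x + sumℤ xs                  ∎
  where open ≡-Reasoning

permuteList : (xs : List ℤ) → Permutation′ (length xs) → List ℤ
permuteList xs π = map (λ j → Vec.lookup (Vec.fromList xs) (π ⟨$⟩ʳ j)) (allFin (length xs))

sumℤ-tabulate : ∀ n (f : Fin n → ℤ) → sumℤ (tabulate f) ≡ Σ.sum f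
sumℤ-tabulate zero f = refl
sumℤ-tabulate (suc n) f = cong (_+_ (f Fin.zero)) (sumℤ-tabulate n (f ∘ Fin.suc))

sumℤ-map≡sum-lookup : ∀ (g : ℤ → ℤ) xs →
                      sumℤ (map g xs) ≡ Σ.sum (g ∘ Vec.lookup (Vec.fromList xs))
sumℤ-map≡sum-lookup g [] = refl
sumℤ-map≡sum-lookup g (x ∷ xs) = cong (_+_ (g x)) (sumℤ-map≡sum-lookup g xs)

sumℤ-map-permuteList : ∀ (g : ℤ → ℤ) xs π → sumℤ (map g (permuteList xs π)) ≡ sumℤ (map g xs)
sumℤ-map-permuteList g xs π = begin
  sumℤ (map g (permuteList xs π))           ≡⟨ cong sumℤ (sym (List.map-∘ (allFin n))) ⟩
  sumℤ (map (g ∘ x ∘ (π ⟨$⟩ʳ_)) (allFin n)) ≡⟨ cong sumℤ (List.map-tabulate id (g ∘ x ∘ (π ⟨$⟩ʳ_))) ⟩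
  sumℤ (tabulate (g ∘ x ∘ (π ⟨$⟩ʳ_)))       ≡⟨ sumℤ-tabulate n (g ∘ x ∘ (π ⟨$⟩ʳ_)) ⟩
  Σ.sum (g ∘ x ∘ (π ⟨$⟩ʳ_))                 ≡⟨ Σ.sum-permute (g ∘ x) π ⟨
  Σ.sum (g ∘ x)                             ≡⟨ sumℤ-map≡sum-lookup g xs ⟨
  sumℤ (map g xs)                           ∎
  where
    open ≡-Reasoning
    n : ℕ
    n = length xs
    x : Fin n → ℤ
    x = Vec.lookup (Vec.fromList xs)

negSum : List ℤ → ℤ
negSum xs = sumℤ (map (_⊓ 0ℤ) xs)

negSum≤0 : ∀ xs → negSum xs ≤ 0ℤ
negSum≤0 [] = ≤-refl
negSum≤0 (x ∷ xs) = +-mono-≤ (i⊓j≤j x 0ℤ) (negSum≤0 xs)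

negSum≤sumℤ-take : ∀ xs i → negSum xs ≤ sumℤ (take i xs)
negSum≤sumℤ-take xs zero = negSum≤0 xs
negSum≤sumℤ-take [] (suc i) = ≤-refl
negSum≤sumℤ-take (x ∷ xs) (suc i) = +-mono-≤ (i⊓j≤i x 0ℤ) (negSum≤sumℤ-take xs i)

-- All that a block has to share with the steps of its rank for the sweep's height bounds.
SameSums : List ℤ → List ℤ → Set
SameSums xs ys = sumℤ xs ≡ sumℤ ys × negSum xs ≡ negSum ys

sameSums-reverse : ∀ xs → SameSums (reverse xs) xs
sameSums-reverse xs =
  sumℤ-reverse xs ,
  trans (cong sumℤ (List.reverse-map (_⊓ 0ℤ) xs)) (sumℤ-reverse (map (_⊓ 0ℤ) xs))

sameSums-permuteList : ∀ xs π → SameSums (permuteList xs π) xs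
sameSums-permuteList xs π =
  trans (cong sumℤ (sym (List.map-id (permuteList xs π))))
        (trans (sumℤ-map-permuteList id xs π) (cong sumℤ (List.map-id xs))) ,
  sumℤ-map-permuteList (_⊓ 0ℤ) xs π

StaysNonnegFrom : ℤ → List ℤ → Set
StaysNonnegFrom h xs = ∀ i → 0ℤ ≤ h + sumℤ (take i xs)

staysNonnegFrom-++ : ∀ h xs ys → StaysNonnegFrom h xs → StaysNonnegFrom (h + sumℤ xs) ys →
                     StaysNonnegFrom h (xs ++ ys)
staysNonnegFrom-++ h [] ys _ ys≥0 i = subst (λ t → 0ℤ ≤ t + sumℤ (take i ys)) (+-identityʳ h) (ys≥0 i)
staysNonnegFrom-++ h (x ∷ xs) ys xs≥0 ys≥0 zero = xs≥0 zero
staysNonnegFrom-++ h (x ∷ xs) ys xs≥0 ys≥0 (suc i) =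
  subst (0ℤ ≤_) (+-assoc h x _)
    (staysNonnegFrom-++ (h + x) xs ys
      (λ k → subst (0ℤ ≤_) (sym (+-assoc h x _)) (xs≥0 (suc k)))
      (λ k → subst (λ t → 0ℤ ≤ t + sumℤ (take k ys)) (sym (+-assoc h x (sumℤ xs))) (ys≥0 k)) i)

staysNonnegFrom-negSum : ∀ h xs → 0ℤ ≤ h + negSum xs → StaysNonnegFrom h xs
staysNonnegFrom-negSum h xs 0≤h+neg i = ≤-trans 0≤h+neg (+-monoʳ-≤ h (negSum≤sumℤ-take xs i))

stepsBelow : ℤ → List (ℤ × ℤ) → List ℤ
stepsBelow r as = map proj₂ (filter (λ p → proj₁ p <? r) as)

stepsBelow-∷-< : s < r → stepsBelow r ((s , b) ∷ as) ≡ b ∷ stepsBelow r as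
stepsBelow-∷-< {r = r} = cong (map proj₂) ∘ List.filter-accept (λ p → proj₁ p <? r)

stepsBelow-∷-≮ : ¬ s < r → stepsBelow r ((s , b) ∷ as) ≡ stepsBelow r as
stepsBelow-∷-≮ {r = r} = cong (map proj₂) ∘ List.filter-reject (λ p → proj₁ p <? r)

stepsAt-∷-≡ : stepsAt r ((r , b) ∷ as) ≡ b ∷ stepsAt r as
stepsAt-∷-≡ {r = r} = cong (map proj₂) (List.filter-accept (λ p → proj₁ p ≟ r) refl)

stepsAt-∷-≢ : ¬ s ≡ r → stepsAt r ((s , b) ∷ as) ≡ stepsAt r as
stepsAt-∷-≢ {r = r} = cong (map proj₂) ∘ List.filter-reject (λ p → proj₁ p ≟ r)

sumℤ-stepsBelow-suc : ∀ r as →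
  sumℤ (stepsBelow (sucℤ r) as) ≡ sumℤ (stepsBelow r as) + sumℤ (stepsAt r as)
sumℤ-stepsBelow-suc r [] = refl
sumℤ-stepsBelow-suc r ((s , b) ∷ as) with <-cmp s r
... | tri< s<r _ _
  rewrite stepsBelow-∷-< {b = b} {as} (i<j⇒i<suc[j] s<r) | stepsBelow-∷-< {b = b} {as} s<r
        | stepsAt-∷-≢ {b = b} {as} (<⇒≢ s<r)
  = trans (cong (_+_ b) (sumℤ-stepsBelow-suc r as)) (sym (+-assoc b _ _))
... | tri≈ _ refl _
  rewrite stepsBelow-∷-< {b = b} {as} (i<suc[i] s) | stepsBelow-∷-≮ {b = b} {as} (<-irrefl {s} refl)
        | stepsAt-∷-≡ {s} {b} {as}
  = trans (cong (_+_ b) (sumℤ-stepsBelow-suc s as))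
          (x∙yz≈y∙xz b (sumℤ (stepsBelow s as)) (sumℤ (stepsAt s as)))
... | tri> s≮r _ r<s
  rewrite stepsBelow-∷-≮ {b = b} {as} (i<j⇒j≮suc[i] r<s) | stepsBelow-∷-≮ {b = b} {as} s≮r
        | stepsAt-∷-≢ {b = b} {as} (<⇒≢ r<s ∘ sym)
  = sumℤ-stepsBelow-suc r as

-- The lowest height the order sweep can reach inside the block of rank r.
sweepFloor : ℤ → List (ℤ × ℤ) → ℤ
sweepFloor r as = sumℤ (stepsBelow r as) + negSum (stepsAt r as)

sweepFloor-∷-< : s < r → sweepFloor r ((s , b) ∷ as) ≡ b + sweepFloor r as
sweepFloor-∷-< {b = b} {as} s<r
  rewrite stepsBelow-∷-< {b = b} {as} s<r | stepsAt-∷-≢ {b = b} {as} (<⇒≢ s<r) = +-assoc b _ _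

sweepFloor-∷-≡ : sweepFloor r ((r , b) ∷ as) ≡ b ⊓ 0ℤ + sweepFloor r as
sweepFloor-∷-≡ {r} {b} {as}
  rewrite stepsBelow-∷-≮ {b = b} {as} (<-irrefl {r} refl) | stepsAt-∷-≡ {r} {b} {as}
  = x∙yz≈y∙xz (sumℤ (stepsBelow r as)) (b ⊓ 0ℤ) (negSum (stepsAt r as))

sweepFloor-∷-> : r < s → sweepFloor r ((s , b) ∷ as) ≡ sweepFloor r as
sweepFloor-∷-> {b = b} {as} r<s
  rewrite stepsBelow-∷-≮ {b = b} {as} (<-asym r<s) | stepsAt-∷-≢ {b = b} {as} (<⇒≢ r<s ∘ sym) = refl

clipped-step : ∀ s b r as →
  (s + b) ⊓ r + sweepFloor r as ≤ s ⊓ r + sweepFloor r ((s , b) ∷ as)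
clipped-step s b r as with <-cmp s r
... | tri< s<r _ _ = begin
  (s + b) ⊓ r + sweepFloor r as ≤⟨ +-monoˡ-≤ _ (i⊓j≤i (s + b) r) ⟩
  s + b + sweepFloor r as       ≡⟨ +-assoc s b _ ⟩
  s + (b + sweepFloor r as)     ≡⟨ cong₂ _+_ (i≤j⇒i⊓j≡i (<⇒≤ s<r)) (sweepFloor-∷-< s<r) ⟨
  s ⊓ r + sweepFloor r ((s , b) ∷ as) ∎
  where open ≤-Reasoning
... | tri≈ _ refl _ = begin
  (s + b) ⊓ s + sweepFloor s as          ≡⟨ cong (λ t → (s + b) ⊓ t + sweepFloor s as) (+-identityʳ s) ⟨
  (s + b) ⊓ (s + 0ℤ) + sweepFloor s as   ≡⟨ cong (_+ sweepFloor s as) (mono-≤-distrib-⊓ (+-monoʳ-≤ s) b 0ℤ) ⟨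
  s + b ⊓ 0ℤ + sweepFloor s as           ≡⟨ +-assoc s _ _ ⟩
  s + (b ⊓ 0ℤ + sweepFloor s as)         ≡⟨ cong₂ _+_ (⊓-idem s) (sweepFloor-∷-≡ {s} {b} {as}) ⟨
  s ⊓ s + sweepFloor s ((s , b) ∷ as)    ∎
  where open ≤-Reasoning
... | tri> _ _ r<s = begin
  (s + b) ⊓ r + sweepFloor r as ≤⟨ +-monoˡ-≤ _ (i⊓j≤j (s + b) r) ⟩
  r + sweepFloor r as           ≡⟨ cong₂ _+_ (i≥j⇒i⊓j≡j (<⇒≤ r<s)) (sweepFloor-∷-> r<s) ⟨
  s ⊓ r + sweepFloor r ((s , b) ∷ as) ∎
  where open ≤-Reasoning

clipped-path : ∀ s bs r → (s + sumℤ bs) ⊓ r ≤ s ⊓ r + sweepFloor r (arrowsFrom s bs)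
clipped-path s [] r = begin
  (s + 0ℤ) ⊓ r     ≡⟨ cong (_⊓ r) (+-identityʳ s) ⟩
  s ⊓ r            ≡⟨ +-identityʳ (s ⊓ r) ⟨
  s ⊓ r + 0ℤ       ∎
  where open ≤-Reasoning
clipped-path s (b ∷ bs) r = begin
  (s + (b + sumℤ bs)) ⊓ r                          ≡⟨ cong (_⊓ r) (+-assoc s b _) ⟨
  (s + b + sumℤ bs) ⊓ r                            ≤⟨ clipped-path (s + b) bs r ⟩
  (s + b) ⊓ r + sweepFloor r (arrowsFrom (s + b) bs) ≤⟨ clipped-step s b r _ ⟩
  s ⊓ r + sweepFloor r (arrowsFrom s (b ∷ bs))     ∎
  where open ≤-Reasoning

sweepFloor-nonneg : ∀ bs → sumℤ bs ≡ 0ℤ → ∀ r → 0ℤ ≤ sweepFloor r (arrowsFrom 0ℤ bs)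
sweepFloor-nonneg bs sum≡0 r =
  i≤i+j⇒0≤j (subst (λ t → (0ℤ + t) ⊓ r ≤ 0ℤ ⊓ r + sweepFloor r (arrowsFrom 0ℤ bs)) sum≡0
                   (clipped-path 0ℤ bs r))

block-staysNonnegFrom : ∀ r as xs → 0ℤ ≤ sweepFloor r as → negSum xs ≡ negSum (stepsAt r as) →
                        StaysNonnegFrom (sumℤ (stepsBelow r as)) xs
block-staysNonnegFrom r as xs floor≥0 neg≡ =
  staysNonnegFrom-negSum (sumℤ (stepsBelow r as)) xs
    (subst (λ t → 0ℤ ≤ sumℤ (stepsBelow r as) + t) (sym neg≡) floor≥0)

concatMap-upTo-suc : ∀ {A : Set} (f : ℕ → List A) n →
                     concatMap f (upTo (suc n)) ≡ concatMap f (upTo n) ++ f n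
concatMap-upTo-suc f n = begin
  concatMap f (upTo (suc n))            ≡⟨ cong (concatMap f) (List.upTo-∷ʳ n) ⟨
  concatMap f (upTo n ++ n ∷ [])        ≡⟨ List.concatMap-++ f (upTo n) (n ∷ []) ⟩
  concatMap f (upTo n) ++ (f n ++ [])   ≡⟨ cong (concatMap f (upTo n) ++_) (List.++-identityʳ (f n)) ⟩
  concatMap f (upTo n) ++ f n           ∎
  where open ≡-Reasoning

module Sweep (as : List (ℤ × ℤ)) (β : ℕ → List ℤ)
             (β-sameSums : ∀ k → SameSums (β k) (stepsAt (+ k) as)) where

  sumℤ-sweep : ∀ n → sumℤ (stepsBelow 0ℤ as) + sumℤ (concatMap β (upTo n)) ≡ sumℤ (stepsBelow (+ n) as)
  sumℤ-sweep zero = +-identityʳ _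
  sumℤ-sweep (suc n) = begin
    S₀ + sumℤ (concatMap β (upTo (suc n))) ≡⟨ cong (λ xs → S₀ + sumℤ xs) (concatMap-upTo-suc β n) ⟩
    S₀ + sumℤ (sweep ++ β n)               ≡⟨ cong (_+_ S₀) (sumℤ-++ sweep (β n)) ⟩
    S₀ + (sumℤ sweep + sumℤ (β n))         ≡⟨ +-assoc S₀ _ _ ⟨
    S₀ + sumℤ sweep + sumℤ (β n)           ≡⟨ cong₂ _+_ (sumℤ-sweep n) (proj₁ (β-sameSums n)) ⟩
    sumℤ (stepsBelow (+ n) as) + sumℤ (stepsAt (+ n) as) ≡⟨ sumℤ-stepsBelow-suc (+ n) as ⟨
    sumℤ (stepsBelow (+ suc n) as)         ∎
    where
      open ≡-Reasoning
      S₀ : ℤ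
      S₀ = sumℤ (stepsBelow 0ℤ as)
      sweep : List ℤ
      sweep = concatMap β (upTo n)

  sweep-staysNonnegFrom : (∀ r → 0ℤ ≤ sweepFloor r as) →
                          ∀ n → StaysNonnegFrom (sumℤ (stepsBelow 0ℤ as)) (concatMap β (upTo n))
  sweep-staysNonnegFrom floor≥0 zero = staysNonnegFrom-negSum (sumℤ (stepsBelow 0ℤ as)) [] $
    ≤-trans (floor≥0 0ℤ) (+-monoʳ-≤ (sumℤ (stepsBelow 0ℤ as)) (negSum≤0 (stepsAt 0ℤ as)))
  sweep-staysNonnegFrom floor≥0 (suc n) =
    subst (StaysNonnegFrom (sumℤ (stepsBelow 0ℤ as))) (sym (concatMap-upTo-suc β n))
      (staysNonnegFrom-++ (sumℤ (stepsBelow 0ℤ as)) (concatMap β (upTo n)) (β n)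
        (sweep-staysNonnegFrom floor≥0 n)
        (subst (λ h → StaysNonnegFrom h (β n)) (sym (sumℤ-sweep n))
          (block-staysNonnegFrom (+ n) as (β n) (floor≥0 (+ n)) (proj₂ (β-sameSums n)))))

map-proj₂-arrowsFrom : ∀ s bs → map proj₂ (arrowsFrom s bs) ≡ bs
map-proj₂-arrowsFrom s [] = refl
map-proj₂-arrowsFrom s (b ∷ bs) = cong (b ∷_) (map-proj₂-arrowsFrom (s + b) bs)

arrowsFrom-ranks≥0 : ∀ s bs → (∀ i → i <ℕ length bs → 0ℤ ≤ s + sumℤ (take i bs)) →
                     All (λ p → 0ℤ ≤ proj₁ p) (arrowsFrom s bs)
arrowsFrom-ranks≥0 s [] _ = []
arrowsFrom-ranks≥0 s (b ∷ bs) prefix≥0 =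
  subst (0ℤ ≤_) (+-identityʳ s) (prefix≥0 0 (s≤s z≤n)) ∷
  arrowsFrom-ranks≥0 (s + b) bs
    (λ i i<n → subst (0ℤ ≤_) (sym (+-assoc s b _)) (prefix≥0 (suc i) (s≤s i<n)))

arrowsFrom-ranks≤ : ∀ s bs → All (λ p → proj₁ p ≤ s + + ℕL.sum (map ∣_∣ bs)) (arrowsFrom s bs)
arrowsFrom-ranks≤ s [] = []
arrowsFrom-ranks≤ s (b ∷ bs) =
  i≤i+j s (+ ℕL.sum (map ∣_∣ (b ∷ bs))) ∷
  All.map (λ rank≤ → ≤-trans rank≤ (step≤ (ℕL.sum (map ∣_∣ bs)))) (arrowsFrom-ranks≤ (s + b) bs)
  where
    step≤ : ∀ n → s + b + + n ≤ s + (+ ∣ b ∣ + + n)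
    step≤ n = ≤-trans (≤-reflexive (+-assoc s b (+ n))) (+-monoʳ-≤ s (+-monoˡ-≤ (+ n) (i≤+∣i∣ b)))

isGeneralDyck⇒ranks≥0 : ∀ {D} → IsGeneralDyck D → All (λ p → 0ℤ ≤ proj₁ p) (arrowsFrom 0ℤ D)
isGeneralDyck⇒ranks≥0 {D} (_ , prefix≥0) =
  arrowsFrom-ranks≥0 0ℤ D (λ i i<n → subst (0ℤ ≤_) (sym (+-identityˡ _)) (prefix≥0 i i<n))

stepsBelow-all : All (λ p → proj₁ p < r) as → stepsBelow r as ≡ map proj₂ as
stepsBelow-all {r} = cong (map proj₂) ∘ List.filter-all (λ p → proj₁ p <? r)

stepsBelow-none : All (λ p → r ≤ proj₁ p) as → stepsBelow r as ≡ []
stepsBelow-none {r} = cong (map proj₂) ∘ List.filter-none (λ p → proj₁ p <? r) ∘ All.map ≤⇒≯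

stepsAt-negative : ∀ m → All (λ p → 0ℤ ≤ proj₁ p) as → stepsAt -[1+ m ] as ≡ []
stepsAt-negative m =
  cong (map proj₂) ∘ List.filter-none (λ p → proj₁ p ≟ -[1+ m ]) ∘
  All.map (λ 0≤s → <⇒≢ (<-≤-trans -<+ 0≤s) ∘ sym)

sweep-isGeneralDyck : ∀ D → IsGeneralDyck D → (β : ℕ → List ℤ) →
  (∀ k → SameSums (β k) (stepsAt (+ k) (arrowsFrom 0ℤ D))) →
  IsGeneralDyck (concatMap β (upTo (suc (ℕL.sum (map ∣_∣ D)))))
sweep-isGeneralDyck D dyck@(sum≡0 , _) β β-sameSums =
  sweep-sum≡0 ,
  λ i _ → subst (0ℤ ≤_) (+-identityˡ _) (subst (λ h → StaysNonnegFrom h sweep) below0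
            (sweep-staysNonnegFrom (sweepFloor-nonneg D sum≡0) (suc B)) i)
  where
    arrows : List (ℤ × ℤ)
    arrows = arrowsFrom 0ℤ D
    B : ℕ
    B = ℕL.sum (map ∣_∣ D)
    sweep : List ℤ
    sweep = concatMap β (upTo (suc B))
    open Sweep arrows β β-sameSums
    below0 : sumℤ (stepsBelow 0ℤ arrows) ≡ 0ℤ
    below0 = cong sumℤ (stepsBelow-none (isGeneralDyck⇒ranks≥0 dyck))
    belowTop : sumℤ (stepsBelow (+ suc B) arrows) ≡ 0ℤ
    belowTop = begin
      sumℤ (stepsBelow (+ suc B) arrows) ≡⟨ cong sumℤ (stepsBelow-all ranks<suc[B]) ⟩
      sumℤ (map proj₂ arrows)            ≡⟨ cong sumℤ (map-proj₂-arrowsFrom 0ℤ D) ⟩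
      sumℤ D                             ≡⟨ sum≡0 ⟩
      0ℤ                                 ∎
      where
        open ≡-Reasoning
        ranks<suc[B] : All (λ p → proj₁ p < + suc B) arrows
        ranks<suc[B] = All.map (suc[i]≤j⇒i<j ∘ suc-mono) (arrowsFrom-ranks≤ 0ℤ D)
    sweep-sum≡0 : sumℤ sweep ≡ 0ℤ
    sweep-sum≡0 = begin
      sumℤ sweep                                   ≡⟨ +-identityˡ (sumℤ sweep) ⟨
      0ℤ + sumℤ sweep                              ≡⟨ cong (_+ sumℤ sweep) below0 ⟨
      sumℤ (stepsBelow 0ℤ arrows) + sumℤ sweep     ≡⟨ sumℤ-sweep (suc B) ⟩
      sumℤ (stepsBelow (+ suc B) arrows)           ≡⟨ belowTop ⟩
      0ℤ                                           ∎
      where open ≡-Reasoning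

osweepBlock : ((k : ℕ) → Permutation′ k) → List (ℤ × ℤ) → ℕ → List ℤ
osweepBlock φ as zero = permuteList (stepsAt 0ℤ as) (φ (length (stepsAt 0ℤ as)))
osweepBlock φ as (suc k) = reverse (stepsAt (+ suc k) as)

osweepBlock-sameSums : ∀ φ as k → SameSums (osweepBlock φ as k) (stepsAt (+ k) as)
osweepBlock-sameSums φ as zero = sameSums-permuteList (stepsAt 0ℤ as) (φ (length (stepsAt 0ℤ as)))
osweepBlock-sameSums φ as (suc k) = sameSums-reverse (stepsAt (+ suc k) as)

Osweep≡concatMap-osweepBlock : ∀ φ D → All (λ p → 0ℤ ≤ proj₁ p) (arrowsFrom 0ℤ D) →
  Osweep φ D ≡ concatMap (osweepBlock φ (arrowsFrom 0ℤ D)) (upTo (suc (ℕL.sum (map ∣_∣ D))))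
Osweep≡concatMap-osweepBlock φ D ranks≥0 = cong (osweepBlock φ arrows 0 ++_) (begin
  concatMap positive (map suc (upTo B)) ++ concatMap negative (reverse (upTo B))
    ≡⟨ cong (concatMap positive (map suc (upTo B)) ++_) (negativeBlocks (reverse (upTo B))) ⟩
  concatMap positive (map suc (upTo B)) ++ []
    ≡⟨ List.++-identityʳ _ ⟩
  concatMap positive (map suc (upTo B))
    ≡⟨ List.concatMap-map positive suc (upTo B) ⟩
  concatMap (osweepBlock φ arrows ∘ suc) (upTo B)
    ≡⟨ List.concatMap-map (osweepBlock φ arrows) suc (upTo B) ⟨
  concatMap (osweepBlock φ arrows) (map suc (upTo B))
    ≡⟨ cong (concatMap (osweepBlock φ arrows)) (List.map-upTo suc B) ⟩
  concatMap (osweepBlock φ arrows) (applyUpTo suc B) ∎)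
  where
    open ≡-Reasoning
    arrows : List (ℤ × ℤ)
    arrows = arrowsFrom 0ℤ D
    B : ℕ
    B = ℕL.sum (map ∣_∣ D)
    positive negative : ℕ → List ℤ
    positive r = reverse (stepsAt (+ r) arrows)
    negative m = reverse (stepsAt -[1+ m ] arrows)
    negativeBlocks : ∀ ms → concatMap negative ms ≡ []
    negativeBlocks [] = refl
    negativeBlocks (m ∷ ms) rewrite stepsAt-negative m ranks≥0 = negativeBlocks ms

corollary1 : (φ : (k : ℕ) → Permutation′ k) → (D : List ℤ) →
    IsGeneralDyck D → IsGeneralDyck (Osweep φ D)
corollary1 φ D dyck =
  subst IsGeneralDyck (sym (Osweep≡concatMap-osweepBlock φ D (isGeneralDyck⇒ranks≥0 dyck)))
    (sweep-isGeneralDyck D dyck (osweepBlock φ arrows) (osweepBlock-sameSums φ arrows))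
  where
    arrows : List (ℤ × ℤ)
    arrows = arrowsFrom 0ℤ D
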